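{- For $n\ge0$, let $v_n$ be the number of words $w_{n-1}\cdots w_0$ of length $n$ over $\{0,1,\dots,9\}$ such that $w_{n-1}\neq0$ (when $n\ge1$) and, for all $i\in\{0,\dots,n-2\}$, $w_{i+1}w_i\neq12$ if $i$ is even and $w_{i+1}w_i\neq89$ if $i$ is odd. Let $x_n$ be the number of words of length $n$ over $\{0,1,\dots,9\}$ that do not start with $0$ and do not contain the factor $10$. (For $n=0$ both counts equal $1$, the empty word.) Then $v_n=x_n$ for all $n\ge0$.
   Context: The sequence $(x_n)$ satisfies $x_0=1$, $x_1=9$, $x_{n+2}=10x_{n+1}-x_n$. -}

module Defs where

open import Data.Nat using (ℕ; zero; suc)
open import Data.Nat.Properties using (_≟_)
open import Data.Nat using (_%_)
open import Data.Product using (_,_)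
open import Relation.Nullary.Decidable using (¬?; _×-dec_; _→-dec_; yes)
open import Data.Fin.Properties using () renaming (_≟_ to _≟ᶠ_)
open import Data.Fin using (Fin; toℕ; fromℕ; inject₁)
open import Data.Fin.Properties using (all?)
open import Data.List using (List; length; filter; allFin; concatMap; map; []; _∷_)
open import Data.Product using (_×_)
open import Data.Unit using (⊤)
open import Relation.Nullary using (¬_)
open import Relation.Unary using (Pred; Decidable)
open import Relation.Binary.PropositionalEquality using (_≡_)
open import Level using (0ℓ)

-- A word w_{n-1} ⋯ w_0 of length n over the alphabet {0,…,9} is represented
-- as a function  w : Fin n → Fin 10,  where  w i  is the letter w_i
-- (index i counts positions from the RIGHT end of the word).
Word : ℕ → Set
Word n = Fin n → Fin 10

_⊲_ : ∀ {n} → Fin 10 → Word n → Word (suc n)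
(d ⊲ w) Fin.zero = d
(d ⊲ w) (Fin.suc i) = w i

allWords : (n : ℕ) → List (Word n)
allWords zero = (λ ()) ∷ []
allWords (suc n) = concatMap (λ d → map (d ⊲_) (allWords n)) (allFin 10)

count : (n : ℕ) (P : Pred (Word n) 0ℓ) → Decidable P → ℕ
count n P P? = length (filter P? (allWords n))

_!_ : ∀ {n} → Word n → Fin n → ℕ
w ! i = toℕ (w i)

NoLeadingZero : (n : ℕ) → Pred (Word n) 0ℓ
NoLeadingZero zero w = ⊤
NoLeadingZero (suc m) w = ¬ (w ! fromℕ m ≡ 0)

FactorAt : ∀ {m} → Word (suc m) → Fin m → ℕ → ℕ → Set
FactorAt w i a b = (w ! Fin.suc i ≡ a) × (w ! inject₁ i ≡ b)

AltAvoid : (n : ℕ) → Pred (Word n) 0ℓ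
AltAvoid zero w = ⊤
AltAvoid (suc m) w = (i : Fin m) →
  ((toℕ i % 2 ≡ 0) → ¬ FactorAt w i 1 2) × ((toℕ i % 2 ≡ 1) → ¬ FactorAt w i 8 9)

Avoid10 : (n : ℕ) → Pred (Word n) 0ℓ
Avoid10 zero w = ⊤
Avoid10 (suc m) w = (i : Fin m) → ¬ FactorAt w i 1 0

V-Pred : (n : ℕ) → Pred (Word n) 0ℓ
V-Pred n w = NoLeadingZero n w × AltAvoid n w

X-Pred : (n : ℕ) → Pred (Word n) 0ℓ
X-Pred n w = NoLeadingZero n w × Avoid10 n w

nlz? : (n : ℕ) → Decidable (NoLeadingZero n)
nlz? zero w = yes _
nlz? (suc m) w = ¬? (w ! fromℕ m ≟ 0)

fac? : ∀ {m} (w : Word (suc m)) (i : Fin m) (a b : ℕ) → Relation.Nullary.Dec (FactorAt w i a b)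
fac? w i a b = (w ! Fin.suc i ≟ a) ×-dec (w ! inject₁ i ≟ b)

alt? : (n : ℕ) → Decidable (AltAvoid n)
alt? zero w = yes _
alt? (suc m) w = all? λ i →
  ((toℕ i % 2 ≟ 0) →-dec ¬? (fac? w i 1 2)) ×-dec ((toℕ i % 2 ≟ 1) →-dec ¬? (fac? w i 8 9))

av10? : (n : ℕ) → Decidable (Avoid10 n)
av10? zero w = yes _
av10? (suc m) w = all? λ i → ¬? (fac? w i 1 0)

v : ℕ → ℕ
v n = count n (V-Pred n) (λ w → nlz? n w ×-dec alt? n w)

x : ℕ → ℕ
x n = count n (X-Pred n) (λ w → nlz? n w ×-dec av10? n w)

-- A schedule forbids at each position i one factor w_{i+1} w_i = a_i b_i; call it admissible
-- when no a_i is 0 and a_i ≠ b_{i+1}. Appending a last letter w_0 to the valid words of length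
-- n+1 for the schedule shifted by one gives 10 A'_{n+1} words; the invalid ones end in a_0 b_0,
-- and since a_0 can neither be a leading zero nor complete the next forbidden factor, removing
-- a_0 b_0 from them leaves an arbitrary valid word of length n for the schedule shifted by two.
-- Hence A_{n+2} + A''_n = 10 A'_{n+1} (the recurrence of x), and as A_0 = 1 and A_1 = 9 for
-- every schedule, the counts do not depend on the admissible schedule. v and x are the counts
-- for the schedules 12, 89, 12, … and 10, 10, ….
module Submission where

open import Defs
open import Data.Nat using (ℕ; zero; suc; _+_; _*_; _%_)
open import Data.Nat.Properties using (+-cancelˡ-≡; +-identityʳ; +-suc; +-0-commutativeMonoid)
open import Data.Fin as Fin using (Fin; toℕ; #_)
open import Data.Fin.Properties using (all?; toℕ-injective; punchInᵢ≢i) renaming (_≟_ to _≟ᶠ_)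
open import Data.Vec.Functional using (Vector; removeAt; tail)
open import Data.List using (List; []; _∷_; _++_; length; filter; map; concatMap; tabulate)
open import Data.List.Properties using (length-++; filter-++; filter-≐; filter-none)
open import Data.List.Relation.Unary.All using (universal)
open import Data.Product using (_×_; _,_; proj₁; proj₂)
open import Data.Unit using (⊤; tt)
open import Function using (_∘_; id; _⇔_; mk⇔; Equivalence)
open import Relation.Nullary using (¬_; yes; no; ¬?)
open import Relation.Nullary.Decidable using (_×-dec_)
open import Relation.Unary using (Pred; Decidable; _≐_; _∩_; ∁)
open import Relation.Unary.Properties using (_∩?_; ∁?)
open import Relation.Binary.PropositionalEquality
open import Level using (0ℓ)
open import Algebra.Properties.CommutativeMonoid.Sum +-0-commutativeMonoid
  using (sum; sum-remove; sum-cong-≗; sum-replicate-zero)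

open ≡-Reasoning
open Equivalence using (to; from)

sum-single : ∀ {q} (t : Vector ℕ (suc q)) (i : Fin (suc q)) →
             (∀ j → j ≢ i → t j ≡ 0) → sum t ≡ t i
sum-single {q} t i vanishes = begin
  sum t                       ≡⟨ sum-remove t ⟩
  t i + sum (removeAt t i)    ≡⟨ cong (t i +_) (sum-cong-≗ (λ j → vanishes _ (punchInᵢ≢i i j))) ⟩
  t i + sum {q} (λ _ → 0)     ≡⟨ cong (t i +_) (sum-replicate-zero q) ⟩
  t i + 0                     ≡⟨ +-identityʳ (t i) ⟩
  t i                         ∎

module _ {A : Set} {P : Pred A 0ℓ} (P? : Decidable P) where

  length-filter-map : ∀ {B : Set} (g : B → A) xs →
                      length (filter P? (map g xs)) ≡ length (filter (P? ∘ g) xs)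
  length-filter-map g [] = refl
  length-filter-map g (x ∷ xs) with P? (g x)
  ... | yes _ = cong suc (length-filter-map g xs)
  ... | no _  = length-filter-map g xs

  length-filter-concatMap-tabulate : ∀ {B : Set} {m} (h : B → List A) (f : Fin m → B) →
    length (filter P? (concatMap h (tabulate f))) ≡ sum (λ i → length (filter P? (h (f i))))
  length-filter-concatMap-tabulate {m = zero}  h f = refl
  length-filter-concatMap-tabulate {m = suc m} h f = begin
    length (filter P? (h (f Fin.zero) ++ rest))
      ≡⟨ cong length (filter-++ P? (h (f Fin.zero)) rest) ⟩
    length (filter P? (h (f Fin.zero)) ++ filter P? rest)
      ≡⟨ length-++ (filter P? (h (f Fin.zero))) ⟩
    length (filter P? (h (f Fin.zero))) + length (filter P? rest)
      ≡⟨ cong (length (filter P? (h (f Fin.zero))) +_) (length-filter-concatMap-tabulate h (f ∘ Fin.suc)) ⟩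
    sum (λ i → length (filter P? (h (f i))))
      ∎
    where
    rest = concatMap h (tabulate (f ∘ Fin.suc))

  module _ {R : Pred A 0ℓ} (R? : Decidable R) where

    length-filter-split : ∀ xs →
      length (filter P? xs) ≡ length (filter (P? ∩? R?) xs) + length (filter (P? ∩? ∁? R?) xs)
    length-filter-split [] = refl
    length-filter-split (x ∷ xs) with P? x | R? x
    ... | yes _ | yes _ = cong suc (length-filter-split xs)
    ... | yes _ | no _  = trans (cong suc (length-filter-split xs)) (sym (+-suc _ _))
    ... | no _  | _     = length-filter-split xs

count-cong : ∀ {n} {P Q : Pred (Word n) 0ℓ} (P? : Decidable P) (Q? : Decidable Q) →
             P ≐ Q → count n P P? ≡ count n Q Q?
count-cong {n} P? Q? P≐Q = cong length (filter-≐ P? Q? P≐Q (allWords n))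

count-split : ∀ {n} {P R : Pred (Word n) 0ℓ} (P? : Decidable P) (R? : Decidable R) →
              count n P P? ≡ count n (P ∩ R) (P? ∩? R?) + count n (P ∩ ∁ R) (P? ∩? ∁? R?)
count-split {n} P? R? = length-filter-split P? R? (allWords n)

count-⊲ : ∀ n {P : Pred (Word (suc n)) 0ℓ} (P? : Decidable P) →
          count (suc n) P P? ≡ sum (λ d → count n (P ∘ (d ⊲_)) (P? ∘ (d ⊲_)))
count-⊲ n P? = trans (length-filter-concatMap-tabulate P? (λ d → map (d ⊲_) (allWords n)) id)
                     (sum-cong-≗ (λ d → length-filter-map P? (d ⊲_) (allWords n)))

count-⊲-fixed : ∀ n {P : Pred (Word (suc n)) 0ℓ} (P? : Decidable P) (b : Fin 10) →
  count (suc n) (λ w → w Fin.zero ≡ b × P w) (λ w → (w Fin.zero ≟ᶠ b) ×-dec P? w)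
    ≡ count n (P ∘ (b ⊲_)) (P? ∘ (b ⊲_))
count-⊲-fixed n {P} P? b = begin
  count (suc n) _ fixed?                      ≡⟨ count-⊲ n fixed? ⟩
  sum (λ d → count n _ (fixed? ∘ (d ⊲_)))     ≡⟨ sum-single _ b vanishes ⟩
  count n _ (fixed? ∘ (b ⊲_))                 ≡⟨ count-cong _ (P? ∘ (b ⊲_)) (proj₂ , (refl ,_)) ⟩
  count n _ (P? ∘ (b ⊲_))                     ∎
  where
  fixed? : Decidable (λ w → w Fin.zero ≡ b × P w)
  fixed? w = (w Fin.zero ≟ᶠ b) ×-dec P? w

  vanishes : ∀ d → d ≢ b → count n _ (fixed? ∘ (d ⊲_)) ≡ 0
  vanishes d d≢b = cong length (filter-none _ (universal (λ _ → d≢b ∘ proj₁) (allWords n)))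

Schedule : Set
Schedule = ℕ → Fin 10 × Fin 10

OccursAt : ∀ {m} → Word (suc m) → Fin m → Fin 10 × Fin 10 → Set
OccursAt w i (a , b) = FactorAt w i (toℕ a) (toℕ b)

Avoids : Schedule → (n : ℕ) → Pred (Word n) 0ℓ
Avoids s zero    w = ⊤
Avoids s (suc m) w = (i : Fin m) → ¬ OccursAt w i (s (toℕ i))

avoids? : ∀ s n → Decidable (Avoids s n)
avoids? s zero    w = yes tt
avoids? s (suc m) w = all? λ i → ¬? (fac? w i _ _)

Valid : Schedule → (n : ℕ) → Pred (Word n) 0ℓ
Valid s n = NoLeadingZero n ∩ Avoids s n

valid? : ∀ s n → Decidable (Valid s n)
valid? s n = nlz? n ∩? avoids? s n

validCount : Schedule → ℕ → ℕ
validCount s n = count n (Valid s n) (valid? s n)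

Admissible : Schedule → Set
Admissible s = ∀ i → toℕ (proj₁ (s i)) ≢ 0 × toℕ (proj₁ (s i)) ≢ toℕ (proj₂ (s (suc i)))

avoids-suc : ∀ s {m} (w : Word (suc (suc m))) →
             Avoids s (suc (suc m)) w ⇔ (¬ OccursAt w Fin.zero (s 0) × Avoids (s ∘ suc) (suc m) (tail w))
avoids-suc s w = mk⇔ (λ avoids → avoids Fin.zero , avoids ∘ Fin.suc)
                     (λ { (first , rest) Fin.zero → first ; (first , rest) (Fin.suc i) → rest i })

valid-⊲ : ∀ s n {a : Fin 10} → toℕ a ≢ 0 → toℕ a ≢ toℕ (proj₂ (s 0)) →
          (Valid s (suc n) ∘ (a ⊲_)) ≐ Valid (s ∘ suc) n
valid-⊲ s zero    a≢0 _   = (λ _ → tt , tt) , (λ _ → a≢0 , λ ())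
valid-⊲ s (suc m) {a} _ a≢b =
  (λ {u} (nlz , avoids) → nlz , proj₂ (to (avoids-suc s (a ⊲ u)) avoids)) ,
  (λ {u} (nlz , avoids) → nlz , from (avoids-suc s (a ⊲ u)) (a≢b ∘ proj₂ , avoids))

validCount-recurrence : ∀ s → Admissible s → ∀ n →
  validCount (s ∘ suc ∘ suc) n + validCount s (2 + n) ≡ 10 * validCount (s ∘ suc) (1 + n)
validCount-recurrence s admissible n = sym (begin
  10 * validCount (s ∘ suc) (1 + n)                    ≡⟨ count-⊲ (1 + n) (V? ∘ tail) ⟨
  count (2 + n) _ (V? ∘ tail)                           ≡⟨ count-split (V? ∘ tail) occurs? ⟩
  count (2 + n) _ (V? ∘ tail ∩? occurs?) + count (2 + n) _ (V? ∘ tail ∩? ∁? occurs?)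
                                                        ≡⟨ cong₂ _+_ occurring avoiding ⟩
  validCount (s ∘ suc ∘ suc) n + validCount s (2 + n)   ∎)
  where
  a = proj₁ (s 0)
  b = proj₂ (s 0)

  V? : Decidable (Valid (s ∘ suc) (1 + n))
  V? = valid? (s ∘ suc) (1 + n)

  occurs? : Decidable (λ w → OccursAt w Fin.zero (s 0))
  occurs? w = fac? w Fin.zero _ _

  avoiding : count (2 + n) _ (V? ∘ tail ∩? ∁? occurs?) ≡ validCount s (2 + n)
  avoiding = count-cong (V? ∘ tail ∩? ∁? occurs?) (valid? s (2 + n))
    ( (λ {w} ((nlz , avoids) , first) → nlz , from (avoids-suc s w) (first , avoids))
    , (λ {w} (nlz , avoids) → let (first , rest) = to (avoids-suc s w) avoids in (nlz , rest) , first))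

  occurring : count (2 + n) _ (V? ∘ tail ∩? occurs?) ≡ validCount (s ∘ suc ∘ suc) n
  occurring = begin
    count (2 + n) _ (V? ∘ tail ∩? occurs?)
      ≡⟨ count-cong (V? ∘ tail ∩? occurs?) fixed?
           ( (λ (valid , p , q) → toℕ-injective q , toℕ-injective p , valid)
           , (λ (q , p , valid) → valid , cong toℕ p , cong toℕ q)) ⟩
    count (2 + n) _ fixed?
      ≡⟨ count-⊲-fixed (1 + n) (λ w → (w (Fin.suc Fin.zero) ≟ᶠ a) ×-dec V? (tail w)) b ⟩
    count (1 + n) _ (λ u → (u Fin.zero ≟ᶠ a) ×-dec V? u)
      ≡⟨ count-⊲-fixed n V? a ⟩
    count n _ (V? ∘ (a ⊲_))
      ≡⟨ count-cong (V? ∘ (a ⊲_)) (valid? (s ∘ suc ∘ suc) n)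
           (valid-⊲ (s ∘ suc) n (proj₁ (admissible 0)) (proj₂ (admissible 0))) ⟩
    validCount (s ∘ suc ∘ suc) n
      ∎
    where
    fixed? : Decidable (λ w → w Fin.zero ≡ b × (w (Fin.suc Fin.zero) ≡ a × Valid (s ∘ suc) (1 + n) (tail w)))
    fixed? w = (w Fin.zero ≟ᶠ b) ×-dec ((w (Fin.suc Fin.zero) ≟ᶠ a) ×-dec V? (tail w))
validCount-schedule-invariant : ∀ s t → Admissible s → Admissible t → ∀ n →
                                validCount s n ≡ validCount t n
validCount-schedule-invariant s t _  _  zero          = refl
validCount-schedule-invariant s t _  _  (suc zero)    = refl
validCount-schedule-invariant s t as at (suc (suc n)) =
  +-cancelˡ-≡ (validCount (s ∘ suc ∘ suc) n) (validCount s (2 + n)) (validCount t (2 + n)) (begin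
    validCount (s ∘ suc ∘ suc) n + validCount s (2 + n)
      ≡⟨ validCount-recurrence s as n ⟩
    10 * validCount (s ∘ suc) (1 + n)
      ≡⟨ cong (10 *_) (validCount-schedule-invariant (s ∘ suc) (t ∘ suc) (as ∘ suc) (at ∘ suc) (suc n)) ⟩
    10 * validCount (t ∘ suc) (1 + n)
      ≡⟨ validCount-recurrence t at n ⟨
    validCount (t ∘ suc ∘ suc) n + validCount t (2 + n)
      ≡⟨ cong (_+ validCount t (2 + n))
              (validCount-schedule-invariant (s ∘ suc ∘ suc) (t ∘ suc ∘ suc) (as ∘ suc ∘ suc) (at ∘ suc ∘ suc) n) ⟨
    validCount (s ∘ suc ∘ suc) n + validCount t (2 + n)
      ∎)

alternating : Schedule
alternating zero          = # 1 , # 2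
alternating (suc zero)    = # 8 , # 9
alternating (suc (suc i)) = alternating i

alternating-admissible : Admissible alternating
alternating-admissible zero          = (λ ()) , (λ ())
alternating-admissible (suc zero)    = (λ ()) , (λ ())
alternating-admissible (suc (suc i)) = alternating-admissible i

alternating-parity : ∀ i (F : Fin 10 × Fin 10 → Set) →
  ((i % 2 ≡ 0 → ¬ F (# 1 , # 2)) × (i % 2 ≡ 1 → ¬ F (# 8 , # 9))) ⇔ (¬ F (alternating i))
alternating-parity zero          F = mk⇔ (λ (even , _) → even refl) (λ ¬F → (λ _ → ¬F) , λ ())
alternating-parity (suc zero)    F = mk⇔ (λ (_ , odd) → odd refl) (λ ¬F → (λ ()) , λ _ → ¬F)
alternating-parity (suc (suc i)) F = alternating-parity i F

v-validCount : ∀ n → v n ≡ validCount alternating n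
v-validCount zero    = refl
v-validCount (suc m) = count-cong _ (valid? alternating (suc m))
  ( (λ {w} (nlz , alt) → nlz , λ i → to (alternating-parity (toℕ i) (OccursAt w i)) (alt i))
  , (λ {w} (nlz , avoids) → nlz , λ i → from (alternating-parity (toℕ i) (OccursAt w i)) (avoids i)))

always10 : Schedule
always10 _ = # 1 , # 0

always10-admissible : Admissible always10
always10-admissible _ = (λ ()) , (λ ())

x-validCount : ∀ n → x n ≡ validCount always10 n
x-validCount zero    = refl
x-validCount (suc m) = refl

corollary2 : (n : ℕ) → v n ≡ x n
corollary2 n = begin
  v n                        ≡⟨ v-validCount n ⟩
  validCount alternating n   ≡⟨ validCount-schedule-invariant alternating always10
                                  alternating-admissible always10-admissible n ⟩
  validCount always10 n      ≡⟨ x-validCount n ⟨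
  x n                        ∎
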